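{- For arbitrary star-finite pointed simplicial models $(\mathcal C,X)$ and $(\mathcal C',X')$, \[ (\mathcal C,X)\equiv_{\mathcal L^+}(\mathcal C',X') \quad\Longrightarrow\quad (\mathcal C,X)\mathrel{\underline{\leftrightarrow}}(\mathcal C',X'). \]
   Context: Let $A$ be a finite set of agents and, for each $a\in A$, $P_a$ a countable set of local atoms (mutually disjoint). The language $\mathcal L^+$ is $\varphi ::= a \mid p_a \mid \neg\varphi \mid (\varphi\wedge\varphi)\mid \widehat K_a\varphi$ with $a\in A$ (global atom "agent $a$ is alive") and $p_a\in P_a$. A simplicial model $\mathcal C=(C,\chi,\ell)$ consists of a nonempty downward-closed set $C$ of nonempty finite subsets (simplexes) of a vertex set containing all singletons, a chromatic map $\chi$ from vertices to agents injective on each simplex, and a valuation $\ell$ assigning to each vertex $v$ a subset of $P_{\chi(v)}$; $\chi(X)$ and $\ell(X)$ are the unions over vertices of $X$; $\mathcal F(C)$ is the set of facets; a pointed model is $(\mathcal C,X)$ with $X\in\mathcal F(C)$. A simplicial model is star-finite iff for each agent $a$, every facet has only finitely many facets $Y$ with $a\in\chi(X\cap Y)$. Three-valued semantics on facets: definability $\bowtie$: $a$ always defined; $p_a$ defined iff $a\in\chi(X)$; $\neg\varphi$ defined iff $\varphi$ is; $\varphi\wedge\psi$ defined iff both are; $\widehat K_a\varphi$ defined iff $\varphi$ is defined in some facet $Y$ with $a\in\chi(X\cap Y)$. Truth $\vDash$: $a$ true iff $a\in\chi(X)$; $p_a$ true iff $p_a\in\ell(X)$; $\neg\varphi$ true iff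 $\varphi$ defined and not true; $\varphi\wedge\psi$ true iff both true; $\widehat K_a\varphi$ true iff $\varphi$ true in some facet $Y$ with $a\in\chi(X\cap Y)$. $(\mathcal C,X)\equiv_{\mathcal L^+}(\mathcal C',X')$ means that for every $\varphi\in\mathcal L^+$, $\varphi$ is defined/true/has true negation in $(\mathcal C,X)$ iff the same holds in $(\mathcal C',X')$. A bisimulation between $\mathcal C$ and $\mathcal C'$ is a nonempty relation $\mathcal B\subseteq\mathcal F(C)\times\mathcal F(C')$ such that whenever $X\mathcal B X'$: (atoms) $\chi(X)=\chi'(X')$ and $\ell(X)=\ell'(X')$; (forth) for each $a$ and each facet $Y$ with $a\in\chi(X\cap Y)$ there is a facet $Y'$ with $a\in\chi'(X'\cap Y')$ and $Y\mathcal B Y'$; (back) symmetrically. $(\mathcal C,X)\mathrel{\underline{\leftrightarrow}}(\mathcal C',X')$ means there is a bisimulation relating $X$ and $X'$. -}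

module Defs where

open import Level using (Level; 0ℓ) renaming (suc to lsuc)
open import Data.Nat using (ℕ)
open import Data.Fin using (Fin)
open import Data.List using (List)
open import Data.List.Membership.Propositional using (_∈_)
open import Data.List.Relation.Unary.Any using (Any)
open import Data.Product using (Σ; ∃; _×_; _,_; proj₁; proj₂)
open import Relation.Nullary using (¬_)
open import Relation.Binary.PropositionalEquality using (_≡_)
open import Function.Bundles using (_⇔_)

-- Agents: the finite set Fin n.  Local atoms of agent a: the type P a.
-- (Mutual disjointness of the P_a is built in: a local atom is a pair (a , p).)
module Logic (n : ℕ) (P : Fin n → Set) where

  Agent : Set
  Agent = Fin n

  data Form : Set where
    glob : Agent → Form                       -- global atom "a is alive"
    loc  : (a : Agent) → P a → Form
    ¬'_  : Form → Form
    _∧'_ : Form → Form → Form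
    K̂    : Agent → Form → Form

  _⊆_ : {V : Set} → (V → Set) → (V → Set) → Set
  S ⊆ T = ∀ v → S v → T v

  record SimplicialModel : Set₁ where
    field
      V : Set
      C : (V → Set) → Set
      simplex-nonempty : ∀ S → C S → ∃ λ v → S v
      simplex-finite   : ∀ S → C S → ∃ λ (xs : List V) → ∀ v → S v → v ∈ xs
      C-nonempty       : ∃ λ S → C S
      down-closed      : ∀ S T → C S → T ⊆ S → (∃ λ v → T v) → C T
      singletons       : ∀ v → C (λ w → w ≡ v)
      χ                : V → Agent
      χ-inj            : ∀ S → C S → ∀ v w → S v → S w → χ v ≡ χ w → v ≡ w
      -- ℓ v a p : "local atom p ∈ P a belongs to ℓ(v)"; ℓ(v) ⊆ P_{χ(v)}
      ℓ                : V → (a : Agent) → P a → Set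
      ℓ-local          : ∀ v a p → ℓ v a p → χ v ≡ a

    IsFacet : (V → Set) → Set₁
    IsFacet S = C S × (∀ T → C T → S ⊆ T → T ⊆ S)

    Facet : Set₁
    Facet = Σ (V → Set) IsFacet

    _∈χ_ : Agent → Facet → Set
    a ∈χ X = ∃ λ v → proj₁ X v × χ v ≡ a

    _∈χ∩_,_ : Agent → Facet → Facet → Set
    a ∈χ∩ X , Y = ∃ λ v → proj₁ X v × proj₁ Y v × χ v ≡ a

    _,_∈ℓ_ : (a : Agent) → P a → Facet → Set
    a , p ∈ℓ X = ∃ λ v → proj₁ X v × ℓ v a p

    _≐_ : Facet → Facet → Set
    X ≐ Y = ∀ v → (proj₁ X v ⇔ proj₁ Y v)

    Def : Form → Facet → Set₁
    True : Form → Facet → Set₁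
    Def (glob a) X = Level.Lift _ Data.Unit.⊤ where import Data.Unit
    Def (loc a p) X = Level.Lift _ (a ∈χ X)
    Def (¬' φ) X = Def φ X
    Def (φ ∧' ψ) X = Def φ X × Def ψ X
    Def (K̂ a φ) X = ∃ λ (Y : Facet) → a ∈χ∩ X , Y × Def φ Y
    True (glob a) X = Level.Lift _ (a ∈χ X)
    True (loc a p) X = Level.Lift _ (a , p ∈ℓ X)
    True (¬' φ) X = Def φ X × ¬ True φ X
    True (φ ∧' ψ) X = True φ X × True ψ X
    True (K̂ a φ) X = ∃ λ (Y : Facet) → a ∈χ∩ X , Y × True φ Y

    StarFinite : Set₁
    StarFinite = ∀ (a : Agent) (X : Facet) →
      ∃ λ (ys : List Facet) →
        ∀ (Y : Facet) → a ∈χ∩ X , Y → Any (λ Z → Y ≐ Z) ys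

  open SimplicialModel public

  L⁺-equiv : (M M' : SimplicialModel) → Facet M → Facet M' → Set₁
  L⁺-equiv M M' X X' = ∀ (φ : Form) →
      (Def M φ X ⇔ Def M' φ X')
    × (True M φ X ⇔ True M' φ X')
    × (True M (¬' φ) X ⇔ True M' (¬' φ) X')

  record IsBisimulation (M M' : SimplicialModel)
         (B : Facet M → Facet M' → Set₁) : Set₁ where
    field
      nonempty : ∃ λ X → ∃ λ X' → B X X'
      atoms-χ  : ∀ X X' → B X X' → ∀ a → (_∈χ_ M a X ⇔ _∈χ_ M' a X')
      atoms-ℓ  : ∀ X X' → B X X' → ∀ a p → (_,_∈ℓ_ M a p X ⇔ _,_∈ℓ_ M' a p X')
      forth    : ∀ X X' → B X X' → ∀ a (Y : Facet M) → _∈χ∩_,_ M a X Y →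
                   ∃ λ (Y' : Facet M') → _∈χ∩_,_ M' a X' Y' × B Y Y'
      back     : ∀ X X' → B X X' → ∀ a (Y' : Facet M') → _∈χ∩_,_ M' a X' Y' →
                   ∃ λ (Y : Facet M) → _∈χ∩_,_ M a X Y × B Y Y'

  Bisimilar : (M M' : SimplicialModel) → Facet M → Facet M' → Set₂
  Bisimilar M M' X X' =
    ∃ λ (B : Facet M → Facet M' → Set₁) → IsBisimulation M M' B × B X X'

{-# OPTIONS --safe #-}
module Submission where

-- The bisimulation is inclusion of theories, Th(Y) ⊆ Th(Z). It is symmetric: if ψ
-- were true at Z but not at Y, then ¬ψ would be true at Y as soon as ψ is defined
-- there, and definedness of ψ is the truth of a formula δ ψ of lower rank, so by
-- induction on rank definedness transfers back from Z to Y. For the forth condition,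
-- star-finiteness leaves finitely many a-neighbours Z of X'; conjoining one formula
-- per Z that is true at Y and false at Z (when there is one) gives φ with K̂_a φ true
-- at X, hence at X', and the neighbour of X' witnessing it contains the theory of Y.

open import Defs
open import Level using (0ℓ; lift; lower) renaming (suc to lsuc)
open import Data.Nat using (ℕ; suc; _≤_; _<_; z≤n; s≤s; _+_)
open import Data.Nat.Properties using (+-mono-≤; +-suc)
open import Data.Nat.Induction using (<-wellFounded)
open import Data.Fin using (Fin)
open import Data.Bool using (Bool; true; false; _∧_)
open import Data.Bool.Properties using (∧-conicalˡ; ∧-conicalʳ)
open import Data.List using (List; []; _∷_; foldr; map)
open import Data.List.Relation.Unary.All using (All; []; _∷_; tabulate; lookupWith)
open import Data.List.Relation.Unary.All.Properties using (map⁺; map⁻)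
open import Data.Product using (Σ; ∃; _×_; _,_; proj₁; proj₂)
open import Data.Unit using (tt)
open import Data.Empty using (⊥-elim)
open import Relation.Nullary using (¬_; yes; no)
open import Relation.Nullary.Decidable using (decidable-stable)
open import Relation.Binary.PropositionalEquality using (_≡_; subst)
open import Induction.WellFounded using (Acc; acc)
open import Function.Base using (_∘_)
open import Function.Bundles using (_↣_; Equivalence; mk⇔)
open import Axiom.ExcludedMiddle using (ExcludedMiddle)

module Semantics (n : ℕ) (P : Fin n → Set) where
  open Logic n P

  tautology : Agent → Form
  tautology a = ¬' (glob a ∧' (¬' glob a))

  glob-only : Form → Bool
  glob-only (glob a)  = true
  glob-only (loc a p) = false
  glob-only (¬' φ)    = glob-only φ
  glob-only (φ ∧' ψ)  = glob-only φ ∧ glob-only ψ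
  glob-only (K̂ a φ)   = false

  -- A formula over global atoms only is defined everywhere, so K̂ b φ is then defined
  -- exactly where b is alive; treating this case separately is what makes δ lower the rank.
  mutual
    δ : Form → Form
    δ (glob a)  = tautology a
    δ (loc a p) = glob a
    δ (¬' φ)    = δ φ
    δ (φ ∧' ψ)  = δ φ ∧' δ ψ
    δ (K̂ b φ)   = δ-K̂ (glob-only φ) b φ

    δ-K̂ : Bool → Agent → Form → Form
    δ-K̂ true  b φ = glob b
    δ-K̂ false b φ = K̂ b (δ φ)

  rank : Form → ℕ
  rank (glob a)  = 0
  rank (loc a p) = 1
  rank (¬' φ)    = rank φ
  rank (φ ∧' ψ)  = rank φ + rank ψ
  rank (K̂ a φ)   = suc (rank φ)

  rank-δ≤ : ∀ φ → rank (δ φ) ≤ rank φ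
  rank-δ≤ (glob a)  = z≤n
  rank-δ≤ (loc a p) = z≤n
  rank-δ≤ (¬' φ)    = rank-δ≤ φ
  rank-δ≤ (φ ∧' ψ)  = +-mono-≤ (rank-δ≤ φ) (rank-δ≤ ψ)
  rank-δ≤ (K̂ b φ) with glob-only φ
  ... | true  = z≤n
  ... | false = s≤s (rank-δ≤ φ)

  rank-δ< : ∀ φ → glob-only φ ≡ false → rank (δ φ) < rank φ
  rank-δ< (loc a p) _ = s≤s z≤n
  rank-δ< (¬' φ) eq   = rank-δ< φ eq
  rank-δ< (φ ∧' ψ) eq with glob-only φ in eqφ
  ... | false = +-mono-≤ (rank-δ< φ eqφ) (rank-δ≤ ψ)
  ... | true  = subst (_≤ rank φ + rank ψ) (+-suc (rank (δ φ)) (rank (δ ψ)))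
                      (+-mono-≤ (rank-δ≤ φ) (rank-δ< ψ eq))
  rank-δ< (K̂ b φ) _ with glob-only φ in eqφ
  ... | true  = s≤s z≤n
  ... | false = s≤s (rank-δ< φ eqφ)

  ⋀ : Agent → List Form → Form
  ⋀ a = foldr _∧'_ (tautology a)

  module _ (M : SimplicialModel) where

    tautology-true : ∀ a X → True M (tautology a) X
    tautology-true a X = (lift tt , lift tt) , λ (alive , (_ , dead)) → dead alive

    true⇒def : ∀ φ X → True M φ X → Def M φ X
    true⇒def (glob a)  X _ = lift tt
    true⇒def (loc a p) X (lift (v , Xv , ℓv)) = lift (v , Xv , ℓ-local M v a p ℓv)
    true⇒def (¬' φ)    X (d , _) = d
    true⇒def (φ ∧' ψ)  X (tφ , tψ) = true⇒def φ X tφ , true⇒def ψ X tψ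
    true⇒def (K̂ a φ)   X (Y , aXY , t) = Y , aXY , true⇒def φ Y t

    ≐-sym : ∀ {X Y} → _≐_ M X Y → _≐_ M Y X
    ≐-sym X≐Y v = mk⇔ (Equivalence.from (X≐Y v)) (Equivalence.to (X≐Y v))

    def-resp-≐ : ∀ φ {X Y} → _≐_ M X Y → Def M φ X → Def M φ Y
    true-resp-≐ : ∀ φ {X Y} → _≐_ M X Y → True M φ X → True M φ Y
    def-resp-≐ (glob a)  _ _ = lift tt
    def-resp-≐ (loc a p) X≐Y (lift (v , Xv , q)) = lift (v , Equivalence.to (X≐Y v) Xv , q)
    def-resp-≐ (¬' φ)    X≐Y d = def-resp-≐ φ X≐Y d
    def-resp-≐ (φ ∧' ψ)  X≐Y (dφ , dψ) = def-resp-≐ φ X≐Y dφ , def-resp-≐ ψ X≐Y dψ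
    def-resp-≐ (K̂ a φ)   X≐Y (W , (v , Xv , Wv , q) , d) =
      W , (v , Equivalence.to (X≐Y v) Xv , Wv , q) , d
    true-resp-≐ (glob a)  X≐Y (lift (v , Xv , q)) = lift (v , Equivalence.to (X≐Y v) Xv , q)
    true-resp-≐ (loc a p) X≐Y (lift (v , Xv , q)) = lift (v , Equivalence.to (X≐Y v) Xv , q)
    true-resp-≐ (¬' φ) {X} {Y} X≐Y (d , nt) =
      def-resp-≐ φ X≐Y d , λ t → nt (true-resp-≐ φ (≐-sym {X} {Y} X≐Y) t)
    true-resp-≐ (φ ∧' ψ)  X≐Y (tφ , tψ) = true-resp-≐ φ X≐Y tφ , true-resp-≐ ψ X≐Y tψ
    true-resp-≐ (K̂ a φ)   X≐Y (W , (v , Xv , Wv , q) , t) =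
      W , (v , Equivalence.to (X≐Y v) Xv , Wv , q) , t

    glob-only⇒def : ∀ φ X → glob-only φ ≡ true → Def M φ X
    glob-only⇒def (glob a) X _  = lift tt
    glob-only⇒def (¬' φ)   X eq = glob-only⇒def φ X eq
    glob-only⇒def (φ ∧' ψ) X eq =
      glob-only⇒def φ X (∧-conicalˡ _ _ eq) , glob-only⇒def ψ X (∧-conicalʳ _ _ eq)

    true-δ⇒def : ∀ φ X → True M (δ φ) X → Def M φ X
    def⇒true-δ : ∀ φ X → Def M φ X → True M (δ φ) X
    true-δ⇒def (glob a)  X _ = lift tt
    true-δ⇒def (loc a p) X t = t
    true-δ⇒def (¬' φ)    X t = true-δ⇒def φ X t
    true-δ⇒def (φ ∧' ψ)  X (tφ , tψ) = true-δ⇒def φ X tφ , true-δ⇒def ψ X tψ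
    true-δ⇒def (K̂ b φ)   X t with glob-only φ in eq
    true-δ⇒def (K̂ b φ) X (lift (v , Xv , χv)) | true  =
      X , (v , Xv , Xv , χv) , glob-only⇒def φ X eq
    true-δ⇒def (K̂ b φ) X (Y , bXY , t)        | false = Y , bXY , true-δ⇒def φ Y t
    def⇒true-δ (glob a)  X _ = tautology-true a X
    def⇒true-δ (loc a p) X d = d
    def⇒true-δ (¬' φ)    X d = def⇒true-δ φ X d
    def⇒true-δ (φ ∧' ψ)  X (dφ , dψ) = def⇒true-δ φ X dφ , def⇒true-δ ψ X dψ
    def⇒true-δ (K̂ b φ)   X d with glob-only φ
    def⇒true-δ (K̂ b φ) X (Y , (v , Xv , Yv , χv) , _) | true = lift (v , Xv , χv)
    def⇒true-δ (K̂ b φ) X (Y , bXY , d)                | false = Y , bXY , def⇒true-δ φ Y d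

    ⋀-true⁺ : ∀ a φs X → All (λ φ → True M φ X) φs → True M (⋀ a φs) X
    ⋀-true⁺ a []       X []       = tautology-true a X
    ⋀-true⁺ a (φ ∷ φs) X (t ∷ ts) = t , ⋀-true⁺ a φs X ts

    ⋀-true⁻ : ∀ a φs X → True M (⋀ a φs) X → All (λ φ → True M φ X) φs
    ⋀-true⁻ a []       X _        = []
    ⋀-true⁻ a (φ ∷ φs) X (t , ts) = t ∷ ⋀-true⁻ a φs X ts

  Th⊆ : (M N : SimplicialModel) → Facet M → Facet N → Set₁
  Th⊆ M N Y Z = ∀ φ → True M φ Y → True N φ Z

module TheoryInclusion (em : ExcludedMiddle (lsuc 0ℓ)) (n : ℕ) (P : Fin n → Set) where
  open Logic n P
  open Semantics n P

  module _ (M N : SimplicialModel) where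

    true-reflected : ∀ {Y Z} → Th⊆ M N Y Z → ∀ φ → Def M φ Y → True N φ Z → True M φ Y
    true-reflected Y⊆Z φ dY tZ =
      decidable-stable em λ ntY → proj₂ (Y⊆Z (¬' φ) (dY , ntY)) tZ

    def-reflected : ∀ {Y Z} → Th⊆ M N Y Z → ∀ φ → Acc _<_ (rank φ) → Def N φ Z → Def M φ Y
    def-reflected {Y} {Z} Y⊆Z φ (acc rs) dZ with glob-only φ in eq
    ... | true  = glob-only⇒def M φ Y eq
    ... | false = true-δ⇒def M φ Y (true-reflected Y⊆Z (δ φ) dδY tδZ)
      where
        tδZ : True N (δ φ) Z
        tδZ = def⇒true-δ N φ Z dZ
        dδY : Def M (δ φ) Y
        dδY = def-reflected Y⊆Z (δ φ) (rs (rank-δ< φ eq)) (true⇒def N (δ φ) Z tδZ)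

    Th⊆-sym : ∀ {Y Z} → Th⊆ M N Y Z → Th⊆ N M Z Y
    Th⊆-sym {Z = Z} Y⊆Z φ tZ =
      true-reflected Y⊆Z φ (def-reflected Y⊆Z φ (<-wellFounded (rank φ)) (true⇒def N φ Z tZ)) tZ

    Th⊆-resp-≐ : ∀ {Y Z W} → Th⊆ M N Y Z → _≐_ N Z W → Th⊆ M N Y W
    Th⊆-resp-≐ Y⊆Z Z≐W φ tY = true-resp-≐ N φ Z≐W (Y⊆Z φ tY)

    separator : Agent → (Y : Facet M) (Z : Facet N) →
                Σ Form λ φ → True M φ Y × (True N φ Z → Th⊆ M N Y Z)
    separator a Y Z with em {∃ λ φ → True M φ Y × ¬ True N φ Z}
    ... | yes (φ , tY , ntZ) = φ , tY , λ tZ → ⊥-elim (ntZ tZ)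
    ... | no none = tautology a , tautology-true M a Y ,
                    λ _ φ tY → decidable-stable em λ ntZ → none (φ , tY , ntZ)

    Th⊆-forth : StarFinite N → ∀ {X X'} → Th⊆ M N X X' → ∀ a Y → _∈χ∩_,_ M a X Y →
                ∃ λ Y' → _∈χ∩_,_ N a X' Y' × Th⊆ M N Y Y'
    Th⊆-forth sfN {X' = X'} X⊆X' a Y aXY =
      conclude (X⊆X' (K̂ a (⋀ a φs)) (Y , aXY , ⋀-true⁺ M a φs Y φs-true-at-Y))
      where
        neighbours : List (Facet N)
        neighbours = proj₁ (sfN a X')
        φs : List Form
        φs = map (proj₁ ∘ separator a Y) neighbours
        φs-true-at-Y : All (λ φ → True M φ Y) φs
        φs-true-at-Y = map⁺ (tabulate λ {Z} _ → proj₁ (proj₂ (separator a Y Z)))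
        separated : ∀ Y' {Z} → True N (proj₁ (separator a Y Z)) Y' → _≐_ N Y' Z → Th⊆ M N Y Y'
        separated Y' {Z} tY' Y'≐Z =
          Th⊆-resp-≐ (proj₂ (proj₂ (separator a Y Z)) (true-resp-≐ N _ Y'≐Z tY'))
                     (≐-sym N {Y'} {Z} Y'≐Z)
        conclude : True N (K̂ a (⋀ a φs)) X' → ∃ λ Y' → _∈χ∩_,_ N a X' Y' × Th⊆ M N Y Y'
        conclude (Y' , aX'Y' , tY') =
          Y' , aX'Y' , lookupWith (separated Y') (map⁻ (⋀-true⁻ N a φs Y' tY'))
                                                 (proj₂ (sfN a X') Y' aX'Y')

  Th⊆⇒bisimilar : ∀ M N → StarFinite M → StarFinite N →
                  ∀ {X X'} → Th⊆ M N X X' → Bisimilar M N X X'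
  Th⊆⇒bisimilar M N sfM sfN {X} {X'} X⊆X' = Th⊆ M N , isBisimulation , X⊆X'
    where
      isBisimulation : IsBisimulation M N (Th⊆ M N)
      isBisimulation = record
        { nonempty = X , X' , X⊆X'
        ; atoms-χ  = λ Y Y' Y⊆Y' a → mk⇔ (λ t → lower (Y⊆Y' (glob a) (lift t)))
                                         (λ t → lower (Th⊆-sym M N Y⊆Y' (glob a) (lift t)))
        ; atoms-ℓ  = λ Y Y' Y⊆Y' a p → mk⇔ (λ t → lower (Y⊆Y' (loc a p) (lift t)))
                                           (λ t → lower (Th⊆-sym M N Y⊆Y' (loc a p) (lift t)))
        ; forth    = λ Y Y' → Th⊆-forth M N sfN
        ; back     = λ Y Y' Y⊆Y' a Z' aY'Z' →
            let Z , aYZ , Z'⊆Z = Th⊆-forth N M sfM (Th⊆-sym M N Y⊆Y') a Z' aY'Z'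
            in  Z , aYZ , Th⊆-sym N M Z'⊆Z
        }

theorem4p13 : ExcludedMiddle (lsuc 0ℓ) →
    (n : ℕ) (P : Fin n → Set) → (∀ a → P a ↣ ℕ) →
    (M M' : Logic.SimplicialModel n P) →
    Logic.StarFinite M → Logic.StarFinite M' →
    (X : Logic.Facet M) (X' : Logic.Facet M') →
    Logic.L⁺-equiv n P M M' X X' → Logic.Bisimilar n P M M' X X'
theorem4p13 em n P _ M M' sfM sfM' X X' X≡X' =
  Th⊆⇒bisimilar M M' sfM sfM' λ φ → Equivalence.to (proj₁ (proj₂ (X≡X' φ)))
  where open TheoryInclusion em n P
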